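{- Let $\mathcal{S}$ be a system and let $k\in\mathbb{N}$. The following are equivalent: (1) every meaningful sequence $Q$ of Boolean operators with $|\dim(Q)|\le k$ commutes on $\mathcal{S}$; (2) for all disjoint sets $Y',Y''$ with $|Y'\cup Y''|\le k$: $\mathrm{Int}_{Y'}(\mathrm{Un}_{Y''}(\mathcal{S}))=\mathrm{Un}_{Y''}(\mathrm{Int}_{Y'}(\mathcal{S}))$; (3) $\mathcal{S}$ is $k$-SE.
   Context: A system is $\mathcal{S}=(S,\{0,1\}^X)$ with $X$ finite, $S\subseteq\{0,1\}^X$, $\dim(\mathcal{S})=X$. For disjoint $A,B$, $f\in\{0,1\}^A$, $g\in\{0,1\}^B$, $g\star f$ is the common extension. Shattering: $\mathcal{S}$ shatters $Y\subseteq X$ if $\forall f\in\{0,1\}^Y\exists g\in\{0,1\}^{X\setminus Y}: g\star f\in S$; strongly shatters if $\exists g\,\forall f$. $\mathcal{S}$ is SE if the families of shattered and strongly shattered sets coincide. For $Y\subseteq X$, a $Y$-cube of $\{0,1\}^X$ is an equivalence class of "agree on $X\setminus Y$"; for such a cube $C$ the restriction $\mathcal{S}|_C=(\{f|_Y: f\in S\cap C\},\{0,1\}^Y)$. $\mathcal{S}$ is $k$-SE if $\mathcal{S}|_C$ is SE for every $Y$-cube $C$ of $\{0,1\}^X$ with $|Y|\le k$. Boolean operators: for a set $Y$, $\mathrm{Int}_Y$ and $\mathrm{Un}_Y$ are defined only on systems with $Y\subseteq\dim(\mathcal{S})$, by $\mathrm{Int}_Y(\mathcal{S})=(\{g\in\{0,1\}^{X\setminus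 Y}:\forall f\in\{0,1\}^Y, g\star f\in S\},\{0,1\}^{X\setminus Y})$ and $\mathrm{Un}_Y(\mathcal{S})=(\{g\in\{0,1\}^{X\setminus Y}:\exists f\in\{0,1\}^Y, g\star f\in S\},\{0,1\}^{X\setminus Y})$; $\dim(\mathrm{Int}_Y)=\dim(\mathrm{Un}_Y)=Y$. Compositions of partial operators are always defined (possibly nowhere defined), and an equation $e_1=e_2$ holds iff both sides are undefined or both are defined and equal. A sequence $Q$ of Boolean operators is meaningful if distinct operators in it have disjoint dimension sets; $\dim(Q)$ is the union of the dimension sets of its operators. $Q(\mathcal{S})$ is the result of applying the operators of $Q$ one after the other; $Q$ commutes on $\mathcal{S}$ if $Q'(\mathcal{S})=Q(\mathcal{S})$ for every permutation $Q'$ of $Q$. -}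

module Defs where

open import Data.Nat using (ℕ; _≤_)
open import Data.Bool using (Bool; if_then_else_)
open import Data.Fin using (Fin)
open import Data.Fin.Subset using (Subset; _∈_; _⊆_; _∩_; _∪_; _─_; ∣_∣; Empty; ⊥)
open import Data.Fin.Subset.Properties using (_⊆?_)
open import Data.Vec using (lookup)
open import Data.Maybe using (Maybe; just; nothing; _>>=_)
open import Data.List using (List; []; _∷_; foldr)
open import Data.List.Relation.Unary.AllPairs using (AllPairs)
open import Data.List.Relation.Binary.Permutation.Propositional using (_↭_)
open import Data.Product using (Σ; ∃; _×_)
open import Relation.Nullary using (yes; no)
open import Relation.Binary.PropositionalEquality using (_≡_)
open import Function.Bundles using (_⇔_)

private variable n : ℕ

-- Elements are drawn from the ambient finite set Fin n.  An assignment
-- g ∈ {0,1}^D (D ⊆ Fin n) is represented by any total function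
-- Fin n → Bool; only its values on D matter.

-- A system: its dimension set D and the set S ⊆ {0,1}^D, given as a
-- predicate on representatives; the set S is the set of restrictions
-- h|_D of those h with mem h.
record System (n : ℕ) : Set₁ where
  field
    dim : Subset n
    mem : (Fin n → Bool) → Set
open System public

_∋_ : System n → (Fin n → Bool) → Set
T ∋ g = ∃ λ h → (∀ i → i ∈ dim T → h i ≡ g i) × mem T h

_⋆[_]_ : (Fin n → Bool) → Subset n → (Fin n → Bool) → (Fin n → Bool)
(g ⋆[ Y ] f) i = if lookup Y i then f i else g i

Disjoint : Subset n → Subset n → Set
Disjoint p q = Empty (p ∩ q)

_≈S_ : System n → System n → Set
T ≈S U = (dim T ≡ dim U) × (∀ g → (T ∋ g) ⇔ (U ∋ g))

data _≈M_ {n : ℕ} : Maybe (System n) → Maybe (System n) → Set₁ where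
  both-undef : nothing ≈M nothing
  both-def   : ∀ {T U} → T ≈S U → just T ≈M just U

IntSys : Subset n → System n → System n
IntSys Y T = record { dim = dim T ─ Y ; mem = λ g → ∀ f → T ∋ (g ⋆[ Y ] f) }

UnSys : Subset n → System n → System n
UnSys Y T = record { dim = dim T ─ Y ; mem = λ g → ∃ λ f → T ∋ (g ⋆[ Y ] f) }

Int : Subset n → System n → Maybe (System n)
Int Y T with Y ⊆? dim T
... | yes _ = just (IntSys Y T)
... | no  _ = nothing

Un : Subset n → System n → Maybe (System n)
Un Y T with Y ⊆? dim T
... | yes _ = just (UnSys Y T)
... | no  _ = nothing

data BoolOp (n : ℕ) : Set where
  int : Subset n → BoolOp n
  un  : Subset n → BoolOp n

opDim : BoolOp n → Subset n
opDim (int Y) = Y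
opDim (un Y)  = Y

applyOp : BoolOp n → System n → Maybe (System n)
applyOp (int Y) = Int Y
applyOp (un Y)  = Un Y

apply : List (BoolOp n) → System n → Maybe (System n)
apply []      T = just T
apply (o ∷ Q) T = applyOp o T >>= apply Q

Meaningful : List (BoolOp n) → Set
Meaningful Q = AllPairs (λ o o' → Disjoint (opDim o) (opDim o')) Q

dimQ : List (BoolOp n) → Subset n
dimQ Q = foldr (λ o Z → opDim o ∪ Z) ⊥ Q

Commutes : List (BoolOp n) → System n → Set₁
Commutes Q T = ∀ Q' → Q' ↭ Q → apply Q' T ≈M apply Q T

Shatters : System n → Subset n → Set
Shatters T Z = ∀ f → ∃ λ g → T ∋ (g ⋆[ Z ] f)

StronglyShatters : System n → Subset n → Set
StronglyShatters T Z = ∃ λ g → ∀ f → T ∋ (g ⋆[ Z ] f)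

SE : System n → Set
SE T = ∀ Z → Z ⊆ dim T → Shatters T Z ⇔ StronglyShatters T Z

-- restriction of T to the Y-cube of {0,1}^(dim T) containing c
-- (Y ⊆ dim T): assignments f|_Y with (c off Y, f on Y) ∈ S
restrict : System n → Subset n → (Fin n → Bool) → System n
restrict T Y c = record { dim = Y ; mem = λ f → T ∋ (c ⋆[ Y ] f) }

kSE : ℕ → System n → Set
kSE k T = ∀ Y → Y ⊆ dim T → ∣ Y ∣ ≤ k → ∀ c → SE (restrict T Y c)

-- Applying a meaningful sequence Q to S, when defined, yields a system squeezed between two
-- quantifier prefixes over the coordinates I of the Int-operators and U of the Un-operators of Q:
-- every g with  ∃u ∀i (g,i,u) ∈ S  lies in Q(S), and every g in Q(S) satisfies  ∀i ∃u (g,i,u) ∈ S.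
-- Neither bound depends on the order of Q, so Q commutes as soon as ∀∃ implies ∃∀ for all
-- disjoint I, U with |I ∪ U| ≤ k.  Conversely this quantifier swap is literally the instance
-- Int_I (Un_U S) = Un_U (Int_I S) of (2), and it says that I is strongly shattered by the
-- restriction of S to an (I ∪ U)-cube whenever it is shattered there, i.e. that S is k-SE.
module Submission where

open import Defs
open import Data.Nat using (ℕ; _≤_)
open import Data.Nat.Properties using (≤-trans)
open import Data.Bool using (Bool; true; false; _∨_)
open import Data.Fin using (Fin)
open import Data.Fin.Subset using (Subset; _∈_; _∉_; _⊆_; _∪_; _─_; ∣_∣; ⊥)
open import Data.Fin.Subset.Properties
  using ( _⊆?_; _∈?_; ∪-identityʳ; p⊆p∪q; q⊆p∪q; x∈p∪q⁻; x∈p∩q⁺; x∈p∩q⁻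
        ; ∪-commutativeMonoid; ∉⊥; ⊆-antisym; p─q⊆p; x∈p∧x∉q⇒x∈p─q; p─⊥≡p; p─q─r≡p─q∪r; p⊆q⇒∣p∣≤∣q∣)
open import Algebra.Bundles using (CommutativeMonoid)
import Algebra.Properties.CommutativeSemigroup
open import Data.Vec using (_∷_; here; there; lookup)
open import Data.Vec.Properties using (lookup-zipWith; lookup-replicate; []=⇒lookup; lookup⇒[]=)
open import Data.Maybe using (just; nothing; _>>=_)
open import Data.List using (List; []; _∷_; foldr)
open import Data.List.Relation.Unary.All using (All; []; _∷_)
open import Data.List.Relation.Unary.AllPairs using ([]; _∷_)
open import Data.List.Relation.Binary.Permutation.Propositional
  using (_↭_; prep; swap; ↭-sym; ↭⇒↭ₛ) renaming (refl to ↭-refl; trans to ↭-trans)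
open import Data.List.Relation.Binary.Permutation.Setoid.Properties using (AllPairs-resp-↭)
open import Data.Product using (_×_; _,_; ∃; proj₂; map₂)
open import Data.Sum using ([_,_])
open import Data.Empty using (⊥-elim)
open import Relation.Nullary using (Dec; yes; no; ¬_; contradiction)
open import Relation.Binary.PropositionalEquality
  using (_≡_; _≗_; refl; sym; trans; cong; subst; subst₂; resp₂; setoid)
open import Function using (id; _∘_)
open import Function.Bundles using (_⇔_; mk⇔; Equivalence)

private variable
  n : ℕ
  A E Y Z : Subset n
  T : System n
  g : Fin n → Bool

lookup≡false⇒∉ : ∀ {i} (p : Subset n) → lookup p i ≡ false → i ∉ p
lookup≡false⇒∉ p eq i∈p with trans (sym ([]=⇒lookup i∈p)) eq
... | ()

disjoint : (∀ {i} → i ∈ A → i ∉ E) → Disjoint A E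
disjoint A∌E (i , i∈A∩E) = let (i∈A , i∈E) = x∈p∩q⁻ _ _ i∈A∩E in A∌E i∈A i∈E

disjoint⁻ : Disjoint A E → ∀ {i} → i ∈ A → i ∉ E
disjoint⁻ A∩E≡∅ i∈A i∈E = A∩E≡∅ (_ , x∈p∩q⁺ (i∈A , i∈E))

Disjoint-sym : Disjoint A E → Disjoint E A
Disjoint-sym d = disjoint λ i∈E i∈A → disjoint⁻ d i∈A i∈E

Disjoint-monoʳ : Z ⊆ E → Disjoint A E → Disjoint A Z
Disjoint-monoʳ Z⊆E d = disjoint λ i∈A i∈Z → disjoint⁻ d i∈A (Z⊆E i∈Z)

x∈p─q⇒x∉q : ∀ (p q : Subset n) {i} → i ∈ p ─ q → i ∉ q
x∈p─q⇒x∉q (_ ∷ p) (_ ∷ q) (there i∈p─q) (there i∈q) = x∈p─q⇒x∉q p q i∈p─q i∈q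
x∈p─q⇒x∉q (_ ∷ p) (_ ∷ q) () here

⊆─ : ∀ {D} → Z ⊆ D → Disjoint Z Y → Z ⊆ D ─ Y
⊆─ Z⊆D Z#Y i∈Z = x∈p∧x∉q⇒x∈p─q (Z⊆D i∈Z) (disjoint⁻ Z#Y i∈Z)

∪-⊆ : ∀ {p q r : Subset n} → p ⊆ r → q ⊆ r → p ∪ q ⊆ r
∪-⊆ p⊆r q⊆r i∈p∪q = [ p⊆r , q⊆r ] (x∈p∪q⁻ _ _ i∈p∪q)

p⊆q⇒p∪[q─p]≡q : ∀ {p q : Subset n} → p ⊆ q → p ∪ (q ─ p) ≡ q
p⊆q⇒p∪[q─p]≡q {p = p} {q} p⊆q = ⊆-antisym (∪-⊆ p⊆q (p─q⊆p q p)) q⊆p∪[q─p]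
  where
  q⊆p∪[q─p] : q ⊆ p ∪ (q ─ p)
  q⊆p∪[q─p] {i} i∈q with i ∈? p
  ... | yes i∈p = p⊆p∪q _ i∈p
  ... | no  i∉p = q⊆p∪q p _ (x∈p∧x∉q⇒x∈p─q i∈q i∉p)

⋆-swap : Disjoint A E → ∀ (g a e : Fin n → Bool) → (g ⋆[ A ] a) ⋆[ E ] e ≗ (g ⋆[ E ] e) ⋆[ A ] a
⋆-swap {A = A} {E = E} A∩E≡∅ g a e i with lookup A i in A[i]≡ | lookup E i in E[i]≡
... | true  | true  = contradiction (lookup⇒[]= i E E[i]≡) (disjoint⁻ A∩E≡∅ (lookup⇒[]= i A A[i]≡))
... | true  | false = refl
... | false | _     = refl

⋆-∪ : ∀ (x a : Fin n → Bool) Y Z → x ⋆[ Y ∪ Z ] a ≗ (x ⋆[ Z ] a) ⋆[ Y ] a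
⋆-∪ x a Y Z i rewrite lookup-zipWith _∨_ i Y Z with lookup Y i
... | true  = refl
... | false = refl

⋆-∪-split : ∀ (x a f : Fin n → Bool) Y Z → x ⋆[ Y ∪ Z ] (a ⋆[ Y ] f) ≗ (x ⋆[ Z ] a) ⋆[ Y ] f
⋆-∪-split x a f Y Z i rewrite lookup-zipWith _∨_ i Y Z with lookup Y i
... | true  = refl
... | false = refl

⋆-⊥ : ∀ (g f : Fin n → Bool) → g ⋆[ ⊥ ] f ≗ g
⋆-⊥ g f i rewrite lookup-replicate i false = refl

⋆-congˡ : ∀ {x x' : Fin n → Bool} Y f → x ≗ x' → x ⋆[ Y ] f ≗ x' ⋆[ Y ] f
⋆-congˡ Y f x≗x' i with lookup Y i
... | true  = refl
... | false = x≗x' i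

⋆-cong-on : ∀ (D : Subset n) {g g' f f'} →
            (∀ {i} → i ∈ D ─ Y → g i ≡ g' i) → (∀ {i} → i ∈ Y → f i ≡ f' i) →
            ∀ {i} → i ∈ D → (g ⋆[ Y ] f) i ≡ (g' ⋆[ Y ] f') i
⋆-cong-on {Y = Y} D g≡g' f≡f' {i} i∈D with lookup Y i in Y[i]≡
... | true  = f≡f' (lookup⇒[]= i Y Y[i]≡)
... | false = g≡g' (x∈p∧x∉q⇒x∈p─q i∈D (lookup≡false⇒∉ Y Y[i]≡))

∋-resp : ∀ {g'} → (∀ {i} → i ∈ dim T → g i ≡ g' i) → T ∋ g → T ∋ g'
∋-resp g≡g' (h , h≡g , h∈T) = h , (λ i i∈D → trans (h≡g i i∈D) (g≡g' i∈D)) , h∈T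

∋-resp-≗ : ∀ {g'} → g ≗ g' → T ∋ g → T ∋ g'
∋-resp-≗ g≗g' = ∋-resp λ {i} _ → g≗g' i

∋-IntSys : IntSys Y T ∋ g ⇔ (∀ f → T ∋ (g ⋆[ Y ] f))
∋-IntSys {T = T} {g = g} = mk⇔
  (λ (h , h≡g , h∈) f → ∋-resp (⋆-cong-on (dim T) {h} {g} {f} (h≡g _) (λ _ → refl)) (h∈ f))
  (λ g∈ → g , (λ _ _ → refl) , g∈)

∋-UnSys : UnSys Y T ∋ g ⇔ (∃ λ f → T ∋ (g ⋆[ Y ] f))
∋-UnSys {T = T} {g = g} = mk⇔
  (λ (h , h≡g , f , h∈) → f , ∋-resp (⋆-cong-on (dim T) {h} {g} {f} (h≡g _) (λ _ → refl)) h∈)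
  (λ g∈ → g , (λ _ _ → refl) , g∈)

∋-restrict : ∀ {c f} → restrict T Y c ∋ f ⇔ T ∋ (c ⋆[ Y ] f)
∋-restrict {T = T} {c = c} {f = f} = mk⇔
  (λ (h , h≡f , h∈) → ∋-resp (⋆-cong-on (dim T) {c} {c} {h} (λ _ → refl) (h≡f _)) h∈)
  (λ f∈ → f , (λ _ _ → refl) , f∈)

Int-defined : Y ⊆ dim T → Int Y T ≡ just (IntSys Y T)
Int-defined {Y = Y} {T = T} Y⊆D with Y ⊆? dim T
... | yes _   = refl
... | no  Y⊈D = ⊥-elim (Y⊈D Y⊆D)

Un-defined : Y ⊆ dim T → Un Y T ≡ just (UnSys Y T)
Un-defined {Y = Y} {T = T} Y⊆D with Y ⊆? dim T
... | yes _   = refl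
... | no  Y⊈D = ⊥-elim (Y⊈D Y⊆D)

AllExists : System n → Subset n → Subset n → (Fin n → Bool) → Set
AllExists T A E g = ∀ a → ∃ λ e → T ∋ ((g ⋆[ A ] a) ⋆[ E ] e)

ExistsAll : System n → Subset n → Subset n → (Fin n → Bool) → Set
ExistsAll T A E g = ∃ λ e → ∀ a → T ∋ ((g ⋆[ A ] a) ⋆[ E ] e)

AllExists-IntSys : Disjoint Y E → AllExists (IntSys Y T) A E g → AllExists T (Y ∪ A) E g
AllExists-IntSys {Y = Y} {E = E} {A = A} {g = g} Y#E ∀∃ a =
  let (e , e∈) = ∀∃ a in
  e , ∋-resp-≗ (λ i → trans (sym (⋆-swap Y#E (g ⋆[ A ] a) a e i)) (⋆-congˡ E e (λ j → sym (⋆-∪ g a Y A j)) i))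
               (Equivalence.to ∋-IntSys e∈ a)

ExistsAll-IntSys : Disjoint Y E → ExistsAll T (Y ∪ A) E g → ExistsAll (IntSys Y T) A E g
ExistsAll-IntSys {Y = Y} {E = E} {A = A} {g = g} Y#E (e , ∃∀) =
  e , λ a → Equivalence.from ∋-IntSys λ f →
    ∋-resp-≗ (λ i → trans (⋆-congˡ E e (⋆-∪-split g a f Y A) i) (⋆-swap Y#E (g ⋆[ A ] a) f e i))
             (∃∀ (a ⋆[ Y ] f))

AllExists-UnSys : AllExists (UnSys Y T) A E g → AllExists T A (Y ∪ E) g
AllExists-UnSys {Y = Y} {A = A} {E = E} {g = g} ∀∃ a =
  let (e , e∈) = ∀∃ a
      (f , f∈) = Equivalence.to ∋-UnSys e∈
  in (e ⋆[ Y ] f) , ∋-resp-≗ (λ i → sym (⋆-∪-split (g ⋆[ A ] a) e f Y E i)) f∈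

ExistsAll-UnSys : ExistsAll T A (Y ∪ E) g → ExistsAll (UnSys Y T) A E g
ExistsAll-UnSys {A = A} {Y = Y} {E = E} {g = g} (e , ∃∀) =
  e , λ a → Equivalence.from ∋-UnSys (e , ∋-resp-≗ (⋆-∪ (g ⋆[ A ] a) e Y E) (∃∀ a))

addInt : BoolOp n → Subset n → Subset n
addInt (int Y) Z = Y ∪ Z
addInt (un _)  Z = Z

addUn : BoolOp n → Subset n → Subset n
addUn (int _) Z = Z
addUn (un Y)  Z = Y ∪ Z

intDim : List (BoolOp n) → Subset n
intDim = foldr addInt ⊥

unDim : List (BoolOp n) → Subset n
unDim = foldr addUn ⊥

foldr-↭ : ∀ {A B : Set} (f : A → B → B) {e : B} → (∀ x y z → f x (f y z) ≡ f y (f x z)) →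
          ∀ {xs ys} → xs ↭ ys → foldr f e xs ≡ foldr f e ys
foldr-↭ f f-comm ↭-refl         = refl
foldr-↭ f f-comm (prep x p)     = cong (f x) (foldr-↭ f f-comm p)
foldr-↭ f f-comm (swap x y p)   = trans (f-comm x y _) (cong (λ z → f y (f x z)) (foldr-↭ f f-comm p))
foldr-↭ f f-comm (↭-trans p p') = trans (foldr-↭ f f-comm p) (foldr-↭ f f-comm p')

∪-left-comm : ∀ (p q r : Subset n) → p ∪ (q ∪ r) ≡ q ∪ (p ∪ r)
∪-left-comm {n} = x∙yz≈y∙xz
  where open Algebra.Properties.CommutativeSemigroup (CommutativeMonoid.commutativeSemigroup (∪-commutativeMonoid n))

dimQ-↭ : ∀ {Q Q' : List (BoolOp n)} → Q ↭ Q' → dimQ Q ≡ dimQ Q'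
dimQ-↭ = foldr-↭ (λ o Z → opDim o ∪ Z) λ o o' → ∪-left-comm (opDim o) (opDim o')

intDim-↭ : ∀ {Q Q' : List (BoolOp n)} → Q ↭ Q' → intDim Q ≡ intDim Q'
intDim-↭ = foldr-↭ addInt addInt-comm
  where
  addInt-comm : ∀ o o' Z → addInt o (addInt o' Z) ≡ addInt o' (addInt o Z)
  addInt-comm (int Y) (int Y') = ∪-left-comm Y Y'
  addInt-comm (int _) (un _)   _ = refl
  addInt-comm (un _)  (int _)  _ = refl
  addInt-comm (un _)  (un _)   _ = refl

unDim-↭ : ∀ {Q Q' : List (BoolOp n)} → Q ↭ Q' → unDim Q ≡ unDim Q'
unDim-↭ = foldr-↭ addUn addUn-comm
  where
  addUn-comm : ∀ o o' Z → addUn o (addUn o' Z) ≡ addUn o' (addUn o Z)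
  addUn-comm (un Y)  (un Y')  = ∪-left-comm Y Y'
  addUn-comm (int _) (int _) _ = refl
  addUn-comm (int _) (un _)  _ = refl
  addUn-comm (un _)  (int _) _ = refl

Meaningful-↭ : ∀ {Q Q' : List (BoolOp n)} → Q ↭ Q' → Meaningful Q → Meaningful Q'
Meaningful-↭ p = AllPairs-resp-↭ (setoid _) Disjoint-sym (resp₂ _) (↭⇒↭ₛ p)

intDim⊆dimQ : ∀ (Q : List (BoolOp n)) → intDim Q ⊆ dimQ Q
intDim⊆dimQ []          = id
intDim⊆dimQ (int Y ∷ Q) = ∪-⊆ (p⊆p∪q _) (q⊆p∪q Y _ ∘ intDim⊆dimQ Q)
intDim⊆dimQ (un Y ∷ Q)  = q⊆p∪q Y _ ∘ intDim⊆dimQ Q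

unDim⊆dimQ : ∀ (Q : List (BoolOp n)) → unDim Q ⊆ dimQ Q
unDim⊆dimQ []          = id
unDim⊆dimQ (int Y ∷ Q) = q⊆p∪q Y _ ∘ unDim⊆dimQ Q
unDim⊆dimQ (un Y ∷ Q)  = ∪-⊆ (p⊆p∪q _) (q⊆p∪q Y _ ∘ unDim⊆dimQ Q)

Disjoint-dimQ : ∀ {Q : List (BoolOp n)} → All (λ o → Disjoint Y (opDim o)) Q → Disjoint Y (dimQ Q)
Disjoint-dimQ []       = disjoint λ _ → ∉⊥
Disjoint-dimQ (d ∷ ds) = disjoint λ i∈Y i∈dimQ →
  [ disjoint⁻ d i∈Y , disjoint⁻ (Disjoint-dimQ ds) i∈Y ] (x∈p∪q⁻ _ _ i∈dimQ)

Meaningful⇒Disjoint : ∀ (Q : List (BoolOp n)) → Meaningful Q → Disjoint (intDim Q) (unDim Q)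
Meaningful⇒Disjoint []          _         = disjoint λ _ → ∉⊥
Meaningful⇒Disjoint (int Y ∷ Q) (ds ∷ mQ) = disjoint λ i∈Y∪I →
  [ disjoint⁻ (Disjoint-monoʳ (unDim⊆dimQ Q) (Disjoint-dimQ ds))
  , disjoint⁻ (Meaningful⇒Disjoint Q mQ) ] (x∈p∪q⁻ _ _ i∈Y∪I)
Meaningful⇒Disjoint (un Y ∷ Q)  (ds ∷ mQ) = disjoint λ i∈I i∈Y∪U →
  [ (λ i∈Y → disjoint⁻ (Disjoint-monoʳ (intDim⊆dimQ Q) (Disjoint-dimQ ds)) i∈Y i∈I)
  , disjoint⁻ (Meaningful⇒Disjoint Q mQ) i∈I ] (x∈p∪q⁻ _ _ i∈Y∪U)

applyOp-defined : ∀ (o : BoolOp n) {U} → applyOp o T ≡ just U → opDim o ⊆ dim T × dim U ≡ dim T ─ opDim o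
applyOp-defined {T = T} (int Y) with Y ⊆? dim T
... | yes Y⊆D = λ { refl → Y⊆D , refl }
... | no  _   = λ ()
applyOp-defined {T = T} (un Y) with Y ⊆? dim T
... | yes Y⊆D = λ { refl → Y⊆D , refl }
... | no  _   = λ ()

apply-defined⇒⊆ : ∀ (Q : List (BoolOp n)) {R} → apply Q T ≡ just R → dimQ Q ⊆ dim T
apply-defined⇒⊆ []               _ i∈⊥ = ⊥-elim (∉⊥ i∈⊥)
apply-defined⇒⊆ {T = T} (o ∷ Q) Q[T]≡R with applyOp o T in o[T]≡U
... | just U = let (o⊆D , dimU≡) = applyOp-defined o o[T]≡U in
  ∪-⊆ o⊆D (p─q⊆p _ _ ∘ subst (_ ∈_) dimU≡ ∘ apply-defined⇒⊆ Q Q[T]≡R)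

apply-undefined : ∀ (Q : List (BoolOp n)) → ¬ (dimQ Q ⊆ dim T) → apply Q T ≡ nothing
apply-undefined {T = T} Q dimQ⊈D with apply Q T in Q[T]≡R
... | nothing = refl
... | just _  = ⊥-elim (dimQ⊈D (apply-defined⇒⊆ Q Q[T]≡R))

dimQ⊆dim─ : ∀ {Q : List (BoolOp n)} → All (λ o → Disjoint Y (opDim o)) Q → Y ∪ dimQ Q ⊆ dim T →
            dimQ Q ⊆ dim T ─ Y
dimQ⊆dim─ {Y = Y} Y#Q Y∪Q⊆D = ⊆─ (Y∪Q⊆D ∘ q⊆p∪q Y _) (Disjoint-sym (Disjoint-dimQ Y#Q))

record Between (T : System n) (A E : Subset n) (R : System n) : Set where
  field
    lower : ∀ {g} → ExistsAll T A E g → R ∋ g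
    upper : ∀ {g} → R ∋ g → AllExists T A E g

record Sandwich (Q : List (BoolOp n)) (T : System n) : Set₁ where
  field
    result     : System n
    applies    : apply Q T ≡ just result
    dim-result : dim result ≡ dim T ─ dimQ Q
    between    : Between T (intDim Q) (unDim Q) result

sandwich : ∀ (Q : List (BoolOp n)) → Meaningful Q → dimQ Q ⊆ dim T → Sandwich Q T
sandwich {T = T} [] _ _ = record
  { result     = T
  ; applies    = refl
  ; dim-result = sym (p─⊥≡p (dim T))
  ; between    = record
    { lower = λ {g} (e , ∃∀) → ∋-resp-≗ (⋆-⊥⋆-⊥ g e g) (∃∀ g)
    ; upper = λ {g} g∈ a → g , ∋-resp-≗ (λ i → sym (⋆-⊥⋆-⊥ g g a i)) g∈
    }
  }
  where
  ⋆-⊥⋆-⊥ : ∀ g e a → (g ⋆[ ⊥ ] a) ⋆[ ⊥ ] e ≗ g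
  ⋆-⊥⋆-⊥ g e a i = trans (⋆-⊥ (g ⋆[ ⊥ ] a) e i) (⋆-⊥ g a i)
sandwich {T = T} (int Y ∷ Q) (Y#Q ∷ mQ) Y∪Q⊆D = record
  { result     = result
  ; applies    = trans (cong (_>>= apply Q) (Int-defined (Y∪Q⊆D ∘ p⊆p∪q (dimQ Q)))) applies
  ; dim-result = trans dim-result (p─q─r≡p─q∪r (dim T) Y (dimQ Q))
  ; between    = record
    { lower = lower ∘ ExistsAll-IntSys Y#U
    ; upper = AllExists-IntSys Y#U ∘ upper
    }
  }
  where
  open Sandwich (sandwich Q mQ (dimQ⊆dim─ {T = T} Y#Q Y∪Q⊆D))
  open Between between
  Y#U : Disjoint Y (unDim Q)
  Y#U = Disjoint-monoʳ (unDim⊆dimQ Q) (Disjoint-dimQ Y#Q)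
sandwich {T = T} (un Y ∷ Q) (Y#Q ∷ mQ) Y∪Q⊆D = record
  { result     = result
  ; applies    = trans (cong (_>>= apply Q) (Un-defined (Y∪Q⊆D ∘ p⊆p∪q (dimQ Q)))) applies
  ; dim-result = trans dim-result (p─q─r≡p─q∪r (dim T) Y (dimQ Q))
  ; between    = record
    { lower = lower ∘ ExistsAll-UnSys {T = T} {A = intDim Q} {Y = Y} {E = unDim Q}
    ; upper = AllExists-UnSys {Y = Y} {T = T} {A = intDim Q} {E = unDim Q} ∘ upper
    }
  }
  where
  open Sandwich (sandwich Q mQ (dimQ⊆dim─ {T = T} Y#Q Y∪Q⊆D))
  open Between between

squeeze : ∀ {R R'} → (∀ {g} → AllExists T A E g → ExistsAll T A E g) →
          Between T A E R → Between T A E R' → dim R ≡ dim R' → R ≈S R'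
squeeze qswap b b' dimR≡dimR' = dimR≡dimR' , λ g → mk⇔ (lower b' ∘ qswap ∘ upper b) (lower b ∘ qswap ∘ upper b')
  where open Between

QuantifierSwap : ℕ → System n → Set
QuantifierSwap k S = ∀ A E → Disjoint A E → ∣ A ∪ E ∣ ≤ k → A ⊆ dim S → E ⊆ dim S →
                     ∀ {g} → AllExists S A E g → ExistsAll S A E g

AllCommute : ℕ → System n → Set₁
AllCommute {n} k S = ∀ (Q : List (BoolOp n)) → Meaningful Q → ∣ dimQ Q ∣ ≤ k → Commutes Q S

IntUnCommute : ℕ → System n → Set₁
IntUnCommute {n} k S = ∀ (Y' Y'' : Subset n) → Disjoint Y' Y'' → ∣ Y' ∪ Y'' ∣ ≤ k →
                       (Un Y'' S >>= Int Y') ≈M (Int Y' S >>= Un Y'')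

QuantifierSwap⇒AllCommute : ∀ {k} {S : System n} → QuantifierSwap k S → AllCommute k S
QuantifierSwap⇒AllCommute {S = S} qswap Q mQ |Q|≤k Q' Q'↭Q with dimQ Q ⊆? dim S
... | no Q⊈D  = subst₂ _≈M_ (sym (apply-undefined Q' (Q⊈D ∘ subst (λ Z → Z ⊆ dim S) (dimQ-↭ Q'↭Q))))
                            (sym (apply-undefined Q Q⊈D)) both-undef
... | yes Q⊆D = subst₂ _≈M_ (sym (applies s')) (sym (applies s))
                            (both-def (squeeze swapQ between' (between s) dim≡))
  where
  open Sandwich
  s : Sandwich Q S
  s = sandwich Q mQ Q⊆D
  s' : Sandwich Q' S
  s' = sandwich Q' (Meaningful-↭ (↭-sym Q'↭Q) mQ) (subst (λ Z → Z ⊆ dim S) (sym (dimQ-↭ Q'↭Q)) Q⊆D)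
  between' : Between S (intDim Q) (unDim Q) (result s')
  between' = subst₂ (λ A E → Between S A E (result s')) (intDim-↭ Q'↭Q) (unDim-↭ Q'↭Q) (between s')
  dim≡ : dim (result s') ≡ dim (result s)
  dim≡ = trans (dim-result s') (trans (cong (dim S ─_) (dimQ-↭ Q'↭Q)) (sym (dim-result s)))
  swapQ : ∀ {g} → AllExists S (intDim Q) (unDim Q) g → ExistsAll S (intDim Q) (unDim Q) g
  swapQ = qswap (intDim Q) (unDim Q) (Meaningful⇒Disjoint Q mQ)
               (≤-trans (p⊆q⇒∣p∣≤∣q∣ (∪-⊆ (intDim⊆dimQ Q) (unDim⊆dimQ Q))) |Q|≤k)
               (Q⊆D ∘ intDim⊆dimQ Q) (Q⊆D ∘ unDim⊆dimQ Q)

apply-pair : ∀ (o o' : BoolOp n) T → apply (o ∷ o' ∷ []) T ≡ (applyOp o T >>= applyOp o')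
apply-pair o o' T with applyOp o T
... | nothing = refl
... | just U with applyOp o' U
...   | nothing = refl
...   | just _  = refl

AllCommute⇒IntUnCommute : ∀ {k} {S : System n} → AllCommute k S → IntUnCommute k S
AllCommute⇒IntUnCommute {k = k} {S} commute Y' Y'' Y'#Y'' |Y'∪Y''|≤k =
  subst₂ _≈M_ (apply-pair (un Y'') (int Y') S) (apply-pair (int Y') (un Y'') S)
    (commute (int Y' ∷ un Y'' ∷ []) ((Y'#Y'' ∷ []) ∷ [] ∷ [])
             (subst (λ Z → ∣ Y' ∪ Z ∣ ≤ k) (sym (∪-identityʳ Y'')) |Y'∪Y''|≤k)
             (un Y'' ∷ int Y' ∷ []) (swap (un Y'') (int Y') ↭-refl))

just-≈M⁻ : ∀ {T U : System n} → just T ≈M just U → T ≈S U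
just-≈M⁻ (both-def T≈U) = T≈U

IntUnCommute⇒QuantifierSwap : ∀ {k} {S : System n} → IntUnCommute k S → QuantifierSwap k S
IntUnCommute⇒QuantifierSwap {S = S} commute A E A#E |A∪E|≤k A⊆D E⊆D {g} ∀∃ =
  let (e , g⋆e∈IntSys) = Equivalence.to ∋-UnSys (Equivalence.to (proj₂ IntUn≈UnInt g) g∈IntUn)
  in e , λ a → ∋-resp-≗ (λ i → sym (⋆-swap A#E g a e i)) (Equivalence.to ∋-IntSys g⋆e∈IntSys a)
  where
  Un∘Int≡ : (Un E S >>= Int A) ≡ just (IntSys A (UnSys E S))
  Un∘Int≡ = trans (cong (_>>= Int A) (Un-defined E⊆D)) (Int-defined (⊆─ A⊆D A#E))
  Int∘Un≡ : (Int A S >>= Un E) ≡ just (UnSys E (IntSys A S))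
  Int∘Un≡ = trans (cong (_>>= Un E) (Int-defined A⊆D)) (Un-defined (⊆─ E⊆D (Disjoint-sym A#E)))
  IntUn≈UnInt : IntSys A (UnSys E S) ≈S UnSys E (IntSys A S)
  IntUn≈UnInt = just-≈M⁻ (subst₂ _≈M_ Un∘Int≡ Int∘Un≡ (commute A E A#E |A∪E|≤k))
  g∈IntUn : IntSys A (UnSys E S) ∋ g
  g∈IntUn = Equivalence.from ∋-IntSys λ a → Equivalence.from ∋-UnSys (∀∃ a)

∋-restrict-∪ : ∀ {h a} → Disjoint A E → restrict T (A ∪ E) g ∋ (h ⋆[ A ] a) ⇔ T ∋ ((g ⋆[ A ] a) ⋆[ E ] h)
∋-restrict-∪ {A = A} {E = E} {g = g} {h} {a} A#E = mk⇔
  (∋-resp-≗ (λ i → trans (⋆-∪-split g h a A E i) (sym (⋆-swap A#E g a h i))) ∘ Equivalence.to ∋-restrict)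
  (Equivalence.from ∋-restrict ∘ ∋-resp-≗ (λ i → trans (⋆-swap A#E g a h i) (sym (⋆-∪-split g h a A E i))))

Shatters-cube⇔ : Disjoint A E → Shatters (restrict T (A ∪ E) g) A ⇔ AllExists T A E g
Shatters-cube⇔ A#E = mk⇔ (λ sh a → map₂ (Equivalence.to (∋-restrict-∪ A#E)) (sh a))
                         (λ ∀∃ a → map₂ (Equivalence.from (∋-restrict-∪ A#E)) (∀∃ a))

StronglyShatters-cube⇔ : Disjoint A E → StronglyShatters (restrict T (A ∪ E) g) A ⇔ ExistsAll T A E g
StronglyShatters-cube⇔ A#E = mk⇔ (map₂ (Equivalence.to (∋-restrict-∪ A#E) ∘_))
                                 (map₂ (Equivalence.from (∋-restrict-∪ A#E) ∘_))

StronglyShatters⇒Shatters : StronglyShatters T Z → Shatters T Z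
StronglyShatters⇒Shatters (g , g⋆f∈) f = g , g⋆f∈ f

kSE⇒QuantifierSwap : ∀ {k} {S : System n} → kSE k S → QuantifierSwap k S
kSE⇒QuantifierSwap SE-cubes A E A#E |A∪E|≤k A⊆D E⊆D {g} =
  Equivalence.to (StronglyShatters-cube⇔ A#E) ∘
  Equivalence.to (SE-cubes (A ∪ E) (∪-⊆ A⊆D E⊆D) |A∪E|≤k g A (p⊆p∪q E)) ∘
  Equivalence.from (Shatters-cube⇔ A#E)

QuantifierSwap⇒kSE : ∀ {k} {S : System n} → QuantifierSwap k S → kSE k S
QuantifierSwap⇒kSE {k = k} {S} qswap Y Y⊆D |Y|≤k c Z Z⊆Y =
  mk⇔ (subst (λ Y → Shatters (restrict S Y c) Z → StronglyShatters (restrict S Y c) Z) Z∪D≡Y shatters⇒strongly)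
      (StronglyShatters⇒Shatters {Z = Z})
  where
  D : Subset _
  D = Y ─ Z
  Z∪D≡Y : Z ∪ D ≡ Y
  Z∪D≡Y = p⊆q⇒p∪[q─p]≡q Z⊆Y
  Z#D : Disjoint Z D
  Z#D = disjoint λ i∈Z i∈D → x∈p─q⇒x∉q Y Z i∈D i∈Z
  shatters⇒strongly : Shatters (restrict S (Z ∪ D) c) Z → StronglyShatters (restrict S (Z ∪ D) c) Z
  shatters⇒strongly =
    Equivalence.from (StronglyShatters-cube⇔ Z#D) ∘
    qswap Z D Z#D (subst (λ V → ∣ V ∣ ≤ k) (sym Z∪D≡Y) |Y|≤k) (Y⊆D ∘ Z⊆Y) (Y⊆D ∘ p─q⊆p Y Z) ∘
    Equivalence.to (Shatters-cube⇔ Z#D)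

mainTheorem4 : (n : ℕ) (S : System n) → (∀ h → Dec (mem S h)) → (k : ℕ) →
    let c1 = ∀ (Q : List (BoolOp n)) → Meaningful Q → ∣ dimQ Q ∣ ≤ k → Commutes Q S
        c2 = ∀ (Y' Y'' : Subset n) → Disjoint Y' Y'' → ∣ Y' ∪ Y'' ∣ ≤ k →
               (Un Y'' S >>= Int Y') ≈M (Int Y' S >>= Un Y'')
        c3 = kSE k S
    in (c1 ⇔ c2) × (c1 ⇔ c3)
mainTheorem4 n S _ k =
  mk⇔ AllCommute⇒IntUnCommute (QuantifierSwap⇒AllCommute ∘ IntUnCommute⇒QuantifierSwap) ,
  mk⇔ (QuantifierSwap⇒kSE ∘ IntUnCommute⇒QuantifierSwap ∘ AllCommute⇒IntUnCommute)
      (QuantifierSwap⇒AllCommute ∘ kSE⇒QuantifierSwap)
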